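{- For each $t\ge1$ and each $k\ge 1$ there exists a $t$-PDDS in $\Lambda_2$ all of whose components are isomorphic to $P_2\square P_k$.
   Context: $\Lambda_2$ is the infinite graph with vertex set $\mathbb{Z}^2$ in which two vertices are adjacent iff their Euclidean distance is $1$; $d$ denotes graph distance. For $S$ a set of vertices, $[S]$ is the induced subgraph and $d(v,C)=\min\{d(v,w):w\in C\}$. For $t\ge1$, $S$ is a $t$-perfect distance-dominating set ($t$-PDDS) if for each vertex $v$ there is a unique component $C_v$ of $[S]$ with $d(v,C_v)\le t$, and there is in $C_v$ a unique vertex $w$ with $d(v,w)=d(v,C_v)$. $P_k$ is the path on $k$ vertices and $\square$ is the Cartesian product of graphs. -}

module Defs where

open import Level using (0ℓ)
open import Data.Nat using (ℕ; zero; suc; _≤_; _<_)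
open import Data.Integer using (ℤ; _+_; _-_; _*_; +_)
open import Data.Fin using (Fin; toℕ)
open import Data.Product using (_×_; Σ; ∃; ∃-syntax; _,_)
open import Data.Sum using (_⊎_)
open import Relation.Unary using (Pred; _∈_)
open import Relation.Binary.PropositionalEquality using (_≡_; _≢_)
open import Function.Bundles using (_⇔_)

V : Set
V = ℤ × ℤ

sq : ℤ → ℤ
sq a = a * a

Adj : V → V → Set
Adj (a , b) (c , d) = sq (a - c) + sq (b - d) ≡ + 1

data Walk : V → V → ℕ → Set where
  here : ∀ {v} → Walk v v 0
  step : ∀ {u v w n} → Adj u v → Walk v w n → Walk u w (suc n)

Dist : V → V → ℕ → Set
Dist v w n = Walk v w n × (∀ m → Walk v w m → n ≤ m)

data WalkIn (S : Pred V 0ℓ) : V → V → Set where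
  here : ∀ {v} → v ∈ S → WalkIn S v v
  step : ∀ {u v w} → u ∈ S → Adj u v → WalkIn S v w → WalkIn S u w

Conn : Pred V 0ℓ → V → V → Set
Conn S u w = WalkIn S u w

-- A component of [S] is represented by any of its vertices c (c ∈ S); its vertex set is {w | Conn S c w}.
-- For every v: there is a component C_v (rep. c) and a vertex w ∈ C_v with d(v,w) = δ ≤ t such that
--   * every other vertex w' of C_v has d(v,w') > δ  (so δ = d(v,C_v) and w is the unique nearest vertex), and
--   * every component C (rep. c') with d(v,C) ≤ t equals C_v  (uniqueness of C_v).
IsPDDS : ℕ → Pred V 0ℓ → Set
IsPDDS t S =
  ∀ (v : V) → Σ V λ c → c ∈ S ×
    (Σ V λ w → Σ ℕ λ δ → Conn S c w × Dist v w δ × δ ≤ t ×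
        (∀ w' δ' → Conn S c w' → w' ≢ w → Dist v w' δ' → δ < δ')) ×
    (∀ c' w' δ' → Conn S c' w' → Dist v w' δ' → δ' ≤ t → Conn S c c')

PathAdj : (n : ℕ) → Fin n → Fin n → Set
PathAdj n i j = suc (toℕ i) ≡ toℕ j ⊎ suc (toℕ j) ≡ toℕ i

GridAdj : (k : ℕ) → Fin 2 × Fin k → Fin 2 × Fin k → Set
GridAdj k (a , i) (b , j) = (a ≡ b × PathAdj k i j) ⊎ (i ≡ j × PathAdj 2 a b)

ComponentIsoGrid : (k : ℕ) → Pred V 0ℓ → V → Set
ComponentIsoGrid k S c =
  Σ (Fin 2 × Fin k → V) λ f →
    (∀ x y → f x ≡ f y → x ≡ y) ×
    (∀ w → Conn S c w ⇔ (∃[ x ] f x ≡ w)) ×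
    (∀ x y → GridAdj k x y ⇔ Adj (f x) (f y))

-- Graph distance in Λ₂ is the ℓ¹ distance, and from any vertex the nearest vertex of an
-- axis-parallel box is unique (clamp each coordinate).  Hence a union of boxes is a t-PDDS whose
-- components are the boxes as soon as distinct boxes are more than 2t apart and every vertex is
-- within t of some box.  Both hold for the 2 × k boxes with lower-left corners
-- p (2t+2, 0) + q (t+1, t+k), p, q ∈ ℤ.  Separation: two such corners differ by
-- ((2p+q)(t+1), q(t+k)), and 2p+q is odd when |q| = 1.  Covering: a vertex in a row of boxes
-- lies in a horizontal gap of width 2t; a vertex between two rows has ℓ¹ distances to a box
-- below and a box above adding up to 2t+1.
module Submission where

open import Defs
open import Level using (0ℓ)
open import Data.Nat using (ℕ; zero; suc; _+_; _*_; _∸_; _≤_; _<_; z≤n; s≤s; _≤?_; ∣_-_∣)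
open import Data.Nat.Properties
open import Data.Integer as ℤ using (ℤ; +_; -[1+_]; ∣_∣)
import Data.Integer.Properties as ℤₚ
open import Data.Integer.DivMod using (_/ℕ_; _%ℕ_; n%ℕd<d; a≡a%ℕn+[a/ℕn]*n)
open import Data.Integer.Tactic.RingSolver using (solve-∀)
import Data.Nat.Tactic.RingSolver as NS
open import Data.Product using (_×_; Σ; ∃-syntax; _,_; proj₁; proj₂)
open import Data.Sum as Sum using (_⊎_; inj₁; inj₂)
open import Relation.Binary.PropositionalEquality
open import Relation.Nullary using (yes; no; contradiction)
open import Relation.Unary using (Pred; _∈_)
open import Data.Fin using (Fin; toℕ; fromℕ<)
open import Data.Fin.Properties using (toℕ-injective; toℕ-fromℕ<; toℕ<n)
open import Function.Bundles using (_⇔_; mk⇔)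
open import Algebra.Properties.CommutativeSemigroup +-commutativeSemigroup using (interchange)

∣+m-+n∣≡∣m-n∣ : ∀ m n → ∣ + m ℤ.- + n ∣ ≡ ∣ m - n ∣
∣+m-+n∣≡∣m-n∣ m n with ≤-total m n
... | inj₁ m≤n = begin
  ∣ + m ℤ.- + n ∣  ≡⟨ cong ∣_∣ (ℤₚ.[+m]-[+n]≡m⊖n m n) ⟩
  ∣ m ℤ.⊖ n ∣      ≡⟨ ℤₚ.∣⊖∣-≤ m≤n ⟩
  n ∸ m            ≡⟨ m≤n⇒∣m-n∣≡n∸m m≤n ⟨
  ∣ m - n ∣        ∎
  where open ≡-Reasoning
... | inj₂ n≤m = begin
  ∣ + m ℤ.- + n ∣  ≡⟨ ℤₚ.∣i-j∣≡∣j-i∣ (+ m) (+ n) ⟩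
  ∣ + n ℤ.- + m ∣  ≡⟨ cong ∣_∣ (ℤₚ.[+m]-[+n]≡m⊖n n m) ⟩
  ∣ n ℤ.⊖ m ∣      ≡⟨ ℤₚ.∣⊖∣-≤ n≤m ⟩
  m ∸ n            ≡⟨ m≤n⇒∣n-m∣≡n∸m n≤m ⟨
  ∣ m - n ∣        ∎
  where open ≡-Reasoning

∣1+n-n∣≡1 : ∀ n → ∣ suc n - n ∣ ≡ 1
∣1+n-n∣≡1 zero    = refl
∣1+n-n∣≡1 (suc n) = ∣1+n-n∣≡1 n

∣m-i∣≡∣m-n∣+∣n-i∣ : ∀ {i n m} → i ≤ n → n ≤ m → ∣ m - i ∣ ≡ ∣ m - n ∣ + ∣ n - i ∣
∣m-i∣≡∣m-n∣+∣n-i∣ {i} {n} {m} i≤n n≤m = begin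
  ∣ m - i ∣              ≡⟨ m≤n⇒∣n-m∣≡n∸m (≤-trans i≤n n≤m) ⟩
  m ∸ i                  ≡⟨ cong (_∸ i) (m∸n+n≡m n≤m) ⟨
  (m ∸ n) + n ∸ i        ≡⟨ +-∸-assoc (m ∸ n) i≤n ⟩
  (m ∸ n) + (n ∸ i)      ≡⟨ cong₂ _+_ (m≤n⇒∣n-m∣≡n∸m n≤m) (m≤n⇒∣n-m∣≡n∸m i≤n) ⟨
  ∣ m - n ∣ + ∣ n - i ∣  ∎
  where open ≡-Reasoning

∣y-x∣+∣y-z∣≡∣z-x∣ : ∀ {x y z} → x ≤ y → y ≤ z → ∣ y - x ∣ + ∣ y - z ∣ ≡ ∣ z - x ∣
∣y-x∣+∣y-z∣≡∣z-x∣ {x} {y} {z} x≤y y≤z = begin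
  ∣ y - x ∣ + ∣ y - z ∣  ≡⟨ +-comm (∣ y - x ∣) (∣ y - z ∣) ⟩
  ∣ y - z ∣ + ∣ y - x ∣  ≡⟨ cong (_+ ∣ y - x ∣) (∣-∣-comm y z) ⟩
  ∣ z - y ∣ + ∣ y - x ∣  ≡⟨ ∣m-i∣≡∣m-n∣+∣n-i∣ x≤y y≤z ⟨
  ∣ z - x ∣              ∎
  where open ≡-Reasoning

∣m-n∣≡1⇒adjacent : ∀ m n → ∣ m - n ∣ ≡ 1 → suc m ≡ n ⊎ suc n ≡ m
∣m-n∣≡1⇒adjacent zero    n       e = inj₁ (sym e)
∣m-n∣≡1⇒adjacent (suc m) zero    e = inj₂ (sym e)
∣m-n∣≡1⇒adjacent (suc m) (suc n) e = Sum.map (cong suc) (cong suc) (∣m-n∣≡1⇒adjacent m n e)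

adjacent⇒∣m-n∣≡1 : ∀ {m n} → suc m ≡ n ⊎ suc n ≡ m → ∣ m - n ∣ ≡ 1
adjacent⇒∣m-n∣≡1 {m} (inj₁ refl) = trans (∣-∣-comm m (suc m)) (∣1+n-n∣≡1 m)
adjacent⇒∣m-n∣≡1 {n = n} (inj₂ refl) = ∣1+n-n∣≡1 n

m+n≡1⇒m≡0×n≡1⊎m≡1×n≡0 : ∀ m n → m + n ≡ 1 → (m ≡ 0 × n ≡ 1) ⊎ (m ≡ 1 × n ≡ 0)
m+n≡1⇒m≡0×n≡1⊎m≡1×n≡0 zero          n    e = inj₁ (refl , e)
m+n≡1⇒m≡0×n≡1⊎m≡1×n≡0 (suc zero)    zero _ = inj₂ (refl , refl)
m+n≡1⇒m≡0×n≡1⊎m≡1×n≡0 (suc zero)    (suc n) ()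
m+n≡1⇒m≡0×n≡1⊎m≡1×n≡0 (suc (suc m)) n    ()

squares≡1⇒sum≡1 : ∀ m n → m * m + n * n ≡ 1 → m + n ≡ 1
squares≡1⇒sum≡1 0 1 _ = refl
squares≡1⇒sum≡1 1 0 _ = refl
squares≡1⇒sum≡1 0 0 ()
squares≡1⇒sum≡1 0 (suc (suc n)) ()
squares≡1⇒sum≡1 1 (suc n) ()
squares≡1⇒sum≡1 (suc (suc m)) n ()

sum≡1⇒squares≡1 : ∀ m n → m + n ≡ 1 → m * m + n * n ≡ 1
sum≡1⇒squares≡1 0 1 _ = refl
sum≡1⇒squares≡1 1 0 _ = refl
sum≡1⇒squares≡1 0 0 ()
sum≡1⇒squares≡1 0 (suc (suc n)) ()
sum≡1⇒squares≡1 1 (suc n) ()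
sum≡1⇒squares≡1 (suc (suc m)) n ()

m+n≡o+1+o⇒m≤o⊎n≤o : ∀ {m n o} → m + n ≡ o + suc o → m ≤ o ⊎ n ≤ o
m+n≡o+1+o⇒m≤o⊎n≤o {m} {n} {o} m+n≡ with m ≤? o
... | yes m≤o = inj₁ m≤o
... | no  m≰o = inj₂ (+-cancelˡ-≤ (suc o) n o (begin
  suc o + n   ≤⟨ +-monoˡ-≤ n (≰⇒> m≰o) ⟩
  m + n       ≡⟨ m+n≡ ⟩
  o + suc o   ≡⟨ +-comm o (suc o) ⟩
  suc o + o   ∎))
  where open ≤-Reasoning

∣a-suc-a∣≡1 : ∀ a → ∣ a ℤ.- ℤ.suc a ∣ ≡ 1
∣a-suc-a∣≡1 a = cong ∣_∣ (minus-one a)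
  where
  minus-one : ∀ a → a ℤ.- (+ 1 ℤ.+ a) ≡ ℤ.- + 1
  minus-one = solve-∀

∣i-k∣≤∣i-j∣+∣j-k∣ : ∀ i j k → ∣ i ℤ.- k ∣ ≤ ∣ i ℤ.- j ∣ + ∣ j ℤ.- k ∣
∣i-k∣≤∣i-j∣+∣j-k∣ i j k =
  subst (λ z → ∣ z ∣ ≤ ∣ i ℤ.- j ∣ + ∣ j ℤ.- k ∣) (telescope i j k) (ℤₚ.∣i+j∣≤∣i∣+∣j∣ (i ℤ.- j) (j ℤ.- k))
  where
  telescope : ∀ i j k → (i ℤ.- j) ℤ.+ (j ℤ.- k) ≡ i ℤ.- k
  telescope = solve-∀

∣i∣≤∣i+j∣+∣j∣ : ∀ i j → ∣ i ∣ ≤ ∣ i ℤ.+ j ∣ + ∣ j ∣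
∣i∣≤∣i+j∣+∣j∣ i j = subst (λ z → ∣ z ∣ ≤ ∣ i ℤ.+ j ∣ + ∣ j ∣) (cancel i j) (ℤₚ.∣i-j∣≤∣i∣+∣j∣ (i ℤ.+ j) j)
  where
  cancel : ∀ i j → (i ℤ.+ j) ℤ.- j ≡ i
  cancel = solve-∀

∣A∣*c≤∣A*c+[m-n]∣+l : ∀ A c {m n l} → m ≤ l → n ≤ l → ∣ A ∣ * c ≤ ∣ A ℤ.* + c ℤ.+ (+ m ℤ.- + n) ∣ + l
∣A∣*c≤∣A*c+[m-n]∣+l A c {m} {n} {l} m≤l n≤l = begin
  ∣ A ∣ * c                                         ≡⟨ ℤₚ.∣i*j∣≡∣i∣*∣j∣ A (+ c) ⟨
  ∣ A ℤ.* + c ∣                                      ≤⟨ ∣i∣≤∣i+j∣+∣j∣ (A ℤ.* + c) (+ m ℤ.- + n) ⟩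
  ∣ A ℤ.* + c ℤ.+ (+ m ℤ.- + n) ∣ + ∣ + m ℤ.- + n ∣  ≡⟨ cong (λ z → ∣ A ℤ.* + c ℤ.+ (+ m ℤ.- + n) ∣ + z) (∣+m-+n∣≡∣m-n∣ m n) ⟩
  ∣ A ℤ.* + c ℤ.+ (+ m ℤ.- + n) ∣ + ∣ m - n ∣        ≤⟨ +-monoʳ-≤ _ (≤-trans (∣m-n∣≤m⊔n m n) (⊔-lub m≤l n≤l)) ⟩
  ∣ A ℤ.* + c ℤ.+ (+ m ℤ.- + n) ∣ + l                ∎
  where open ≤-Reasoning

∣i+i∣≤1⇒i≡0 : ∀ i → ∣ i ℤ.+ i ∣ ≤ 1 → i ≡ + 0
∣i+i∣≤1⇒i≡0 (+ zero)  _ = refl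
∣i+i∣≤1⇒i≡0 (+ suc n) le with () ← ≤-pred (subst (_≤ 1) (cong suc (+-suc n n)) le)
∣i+i∣≤1⇒i≡0 -[1+ n ]  (s≤s ())

small-2P+D⇒P≡0×D≡0 : ∀ P D → (∣ D ∣ ≡ 0 × ∣ P ℤ.+ P ℤ.+ D ∣ ≤ 1) ⊎ (∣ D ∣ ≡ 1 × ∣ P ℤ.+ P ℤ.+ D ∣ ≡ 0) →
                      P ≡ + 0 × D ≡ + 0
small-2P+D⇒P≡0×D≡0 P D (inj₁ (∣D∣≡0 , ∣A∣≤1)) = ∣i+i∣≤1⇒i≡0 P (subst (_≤ 1) ∣A∣≡∣P+P∣ ∣A∣≤1) , D≡0
  where
  D≡0 = ℤₚ.∣i∣≡0⇒i≡0 ∣D∣≡0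
  ∣A∣≡∣P+P∣ : ∣ P ℤ.+ P ℤ.+ D ∣ ≡ ∣ P ℤ.+ P ∣
  ∣A∣≡∣P+P∣ = trans (cong (λ z → ∣ P ℤ.+ P ℤ.+ z ∣) D≡0) (cong ∣_∣ (ℤₚ.+-identityʳ (P ℤ.+ P)))
small-2P+D⇒P≡0×D≡0 P D (inj₂ (∣D∣≡1 , ∣A∣≡0)) with ∣i+i∣≤1⇒i≡0 P (≤-reflexive ∣P+P∣≡1)
  where
  ∣P+P∣≡1 : ∣ P ℤ.+ P ∣ ≡ 1
  ∣P+P∣≡1 = begin
    ∣ P ℤ.+ P ∣                ≡⟨ cong ∣_∣ (minus-D P D) ⟩
    ∣ P ℤ.+ P ℤ.+ D ℤ.- D ∣    ≡⟨ cong (λ z → ∣ z ℤ.- D ∣) (ℤₚ.∣i∣≡0⇒i≡0 {P ℤ.+ P ℤ.+ D} ∣A∣≡0) ⟩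
    ∣ + 0 ℤ.- D ∣              ≡⟨ cong ∣_∣ (ℤₚ.+-identityˡ (ℤ.- D)) ⟩
    ∣ ℤ.- D ∣                  ≡⟨ ℤₚ.∣-i∣≡∣i∣ D ⟩
    ∣ D ∣                      ≡⟨ ∣D∣≡1 ⟩
    1                          ∎
    where
    open ≡-Reasoning
    minus-D : ∀ P D → P ℤ.+ P ≡ P ℤ.+ P ℤ.+ D ℤ.- D
    minus-D = solve-∀
... | refl = contradiction (trans (sym ∣D∣≡1) (trans (cong ∣_∣ (sym (ℤₚ.+-identityˡ D))) ∣A∣≡0)) λ ()

-- Graph distance in Λ₂

d₁ : V → V → ℕ
d₁ (a , b) (c , d) = ∣ a ℤ.- c ∣ + ∣ b ℤ.- d ∣

sq≡∣∣*∣∣ : ∀ z → sq z ≡ + (∣ z ∣ * ∣ z ∣)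
sq≡∣∣*∣∣ (+ n)    = sym (ℤₚ.pos-* n n)
sq≡∣∣*∣∣ -[1+ n ] = refl

sq+sq≡ : ∀ a b c d →
  sq (a ℤ.- c) ℤ.+ sq (b ℤ.- d) ≡ + (∣ a ℤ.- c ∣ * ∣ a ℤ.- c ∣ + ∣ b ℤ.- d ∣ * ∣ b ℤ.- d ∣)
sq+sq≡ a b c d =
  trans (cong₂ ℤ._+_ (sq≡∣∣*∣∣ (a ℤ.- c)) (sq≡∣∣*∣∣ (b ℤ.- d))) (sym (ℤₚ.pos-+ (∣ a ℤ.- c ∣ * ∣ a ℤ.- c ∣) (∣ b ℤ.- d ∣ * ∣ b ℤ.- d ∣)))

Adj⇒d₁≡1 : ∀ u v → Adj u v → d₁ u v ≡ 1
Adj⇒d₁≡1 (a , b) (c , d) adj =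
  squares≡1⇒sum≡1 (∣ a ℤ.- c ∣) (∣ b ℤ.- d ∣) (ℤₚ.+-injective (trans (sym (sq+sq≡ a b c d)) adj))

d₁≡1⇒Adj : ∀ u v → d₁ u v ≡ 1 → Adj u v
d₁≡1⇒Adj (a , b) (c , d) d≡1 = trans (sq+sq≡ a b c d) (cong +_ (sum≡1⇒squares≡1 (∣ a ℤ.- c ∣) (∣ b ℤ.- d ∣) d≡1))

d₁-sym : ∀ u v → d₁ u v ≡ d₁ v u
d₁-sym (a , b) (c , d) = cong₂ _+_ (ℤₚ.∣i-j∣≡∣j-i∣ a c) (ℤₚ.∣i-j∣≡∣j-i∣ b d)

Adj-sym : ∀ u v → Adj u v → Adj v u
Adj-sym u v adj = d₁≡1⇒Adj v u (trans (d₁-sym v u) (Adj⇒d₁≡1 u v adj))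

d₁-self : ∀ u → d₁ u u ≡ 0
d₁-self (a , b) = cong₂ _+_ (cong ∣_∣ (ℤₚ.+-inverseʳ a)) (cong ∣_∣ (ℤₚ.+-inverseʳ b))

d₁-triangle : ∀ u v w → d₁ u w ≤ d₁ u v + d₁ v w
d₁-triangle (a , b) (c , d) (e , f) = begin
  ∣ a ℤ.- e ∣ + ∣ b ℤ.- f ∣                                  ≤⟨ +-mono-≤ (∣i-k∣≤∣i-j∣+∣j-k∣ a c e) (∣i-k∣≤∣i-j∣+∣j-k∣ b d f) ⟩
  (∣ a ℤ.- c ∣ + ∣ c ℤ.- e ∣) + (∣ b ℤ.- d ∣ + ∣ d ℤ.- f ∣)  ≡⟨ interchange (∣ a ℤ.- c ∣) (∣ c ℤ.- e ∣) (∣ b ℤ.- d ∣) (∣ d ℤ.- f ∣) ⟩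
  (∣ a ℤ.- c ∣ + ∣ b ℤ.- d ∣) + (∣ c ℤ.- e ∣ + ∣ d ℤ.- f ∣)  ∎
  where open ≤-Reasoning

_++ʷ_ : ∀ {u v w m n} → Walk u v m → Walk v w n → Walk u w (m + n)
here       ++ʷ q = q
step adj p ++ʷ q = step adj (p ++ʷ q)

_▷ʷ_ : ∀ {u v w n} → Walk u v n → Adj v w → Walk u w (suc n)
here       ▷ʷ adj′ = step adj′ here
step adj p ▷ʷ adj′ = step adj (p ▷ʷ adj′)

reverseʷ : ∀ {u w n} → Walk u w n → Walk w u n
reverseʷ here         = here
reverseʷ {u} (step {v = v} adj p) = reverseʷ p ▷ʷ Adj-sym u v adj

d₁≤length : ∀ {u w n} → Walk u w n → d₁ u w ≤ n
d₁≤length {u} here = ≤-reflexive (d₁-self u)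
d₁≤length {u} {w} {suc n} (step {v = v} adj p) = begin
  d₁ u w            ≤⟨ d₁-triangle u v w ⟩
  d₁ u v + d₁ v w   ≡⟨ cong (_+ d₁ v w) (Adj⇒d₁≡1 u v adj) ⟩
  suc (d₁ v w)      ≤⟨ s≤s (d₁≤length p) ⟩
  suc n             ∎
  where open ≤-Reasoning

module _ (f : ℤ → V) (adj-suc : ∀ a → Adj (f a) (f (ℤ.suc a))) where

  walk-forward : ∀ n a → Walk (f a) (f (a ℤ.+ + n)) n
  walk-forward zero    a = subst (λ x → Walk (f a) (f x) 0) (sym (ℤₚ.+-identityʳ a)) here
  walk-forward (suc n) a = step (adj-suc a) (subst (λ x → Walk (f (ℤ.suc a)) (f x) n) (shift a (+ n)) (walk-forward n (ℤ.suc a)))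
    where
    shift : ∀ a m → (+ 1 ℤ.+ a) ℤ.+ m ≡ a ℤ.+ (+ 1 ℤ.+ m)
    shift = solve-∀

  line-walk : ∀ a c → Walk (f a) (f c) ∣ a ℤ.- c ∣
  line-walk a c with ℤₚ.+∣i∣≡i⊎+∣i∣≡-i (a ℤ.- c)
  ... | inj₁ e = reverseʷ (subst (λ x → Walk (f c) (f x) ∣ a ℤ.- c ∣) (trans (cong (λ x → c ℤ.+ x) e) (back c a)) (walk-forward _ c))
    where
    back : ∀ c a → c ℤ.+ (a ℤ.- c) ≡ a
    back = solve-∀
  ... | inj₂ e = subst (λ x → Walk (f a) (f x) ∣ a ℤ.- c ∣) (trans (cong (λ x → a ℤ.+ x) e) (forth a c)) (walk-forward _ a)
    where
    forth : ∀ a c → a ℤ.+ ℤ.- (a ℤ.- c) ≡ c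
    forth = solve-∀

geodesic : ∀ u w → Walk u w (d₁ u w)
geodesic (a , b) (c , d) = line-walk (_, b) horizontal a c ++ʷ line-walk (c ,_) vertical b d
  where
  horizontal : ∀ x → Adj (x , b) (ℤ.suc x , b)
  horizontal x = d₁≡1⇒Adj (x , b) (ℤ.suc x , b) (cong₂ _+_ (∣a-suc-a∣≡1 x) (cong ∣_∣ (ℤₚ.+-inverseʳ b)))
  vertical : ∀ y → Adj (c , y) (c , ℤ.suc y)
  vertical y = d₁≡1⇒Adj (c , y) (c , ℤ.suc y) (cong₂ _+_ (cong ∣_∣ (ℤₚ.+-inverseʳ c)) (∣a-suc-a∣≡1 y))

Dist-d₁ : ∀ u w → Dist u w (d₁ u w)
Dist-d₁ u w = geodesic u w , λ _ → d₁≤length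

-- Packings of boxes

_⊕_ : V → ℕ × ℕ → V
(x , y) ⊕ (i , j) = (x ℤ.+ + i , y ℤ.+ + j)

d₁ℕ : ℕ × ℕ → ℕ × ℕ → ℕ
d₁ℕ (i , j) (i′ , j′) = ∣ i - i′ ∣ + ∣ j - j′ ∣

d₁-⊕ : ∀ c p p′ → d₁ (c ⊕ p) (c ⊕ p′) ≡ d₁ℕ p p′
d₁-⊕ (x , y) (i , j) (i′ , j′) = cong₂ _+_ (along x i i′) (along y j j′)
  where
  cancel : ∀ x m n → (x ℤ.+ m) ℤ.- (x ℤ.+ n) ≡ m ℤ.- n
  cancel = solve-∀
  along : ∀ x m n → ∣ (x ℤ.+ + m) ℤ.- (x ℤ.+ + n) ∣ ≡ ∣ m - n ∣
  along x m n = trans (cong ∣_∣ (cancel x (+ m) (+ n))) (∣+m-+n∣≡∣m-n∣ m n)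

d₁ℕ≡0⇒≡ : ∀ p p′ → d₁ℕ p p′ ≡ 0 → p ≡ p′
d₁ℕ≡0⇒≡ (i , j) (i′ , j′) d≡0 =
  cong₂ _,_ (∣m-n∣≡0⇒m≡n (m+n≡0⇒m≡0 _ d≡0)) (∣m-n∣≡0⇒m≡n (m+n≡0⇒n≡0 (∣ i - i′ ∣) d≡0))

nearest-in-interval : ∀ x n → Σ ℕ λ c → c ≤ n ×
  (∀ {i} → i ≤ n → ∣ x ℤ.- + i ∣ ≡ ∣ x ℤ.- + c ∣ + ∣ c - i ∣)
nearest-in-interval -[1+ m ] n = 0 , z≤n , λ {i} _ → below i
  where
  below : ∀ i → ∣ -[1+ m ] ℤ.- + i ∣ ≡ suc m + i
  below zero    = sym (+-identityʳ (suc m))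
  below (suc i) = cong suc (sym (+-suc m i))
nearest-in-interval (+ m) n with m ≤? n
... | yes m≤n = m , m≤n , λ {i} _ → begin
  ∣ + m ℤ.- + i ∣                  ≡⟨ ∣+m-+n∣≡∣m-n∣ m i ⟩
  ∣ m - i ∣                        ≡⟨ cong (_+ ∣ m - i ∣) (∣n-n∣≡0 m) ⟨
  ∣ m - m ∣ + ∣ m - i ∣            ≡⟨ cong (_+ ∣ m - i ∣) (∣+m-+n∣≡∣m-n∣ m m) ⟨
  ∣ + m ℤ.- + m ∣ + ∣ m - i ∣      ∎
  where open ≡-Reasoning
... | no m≰n = n , ≤-refl , λ {i} i≤n → begin
  ∣ + m ℤ.- + i ∣                  ≡⟨ ∣+m-+n∣≡∣m-n∣ m i ⟩
  ∣ m - i ∣                        ≡⟨ ∣m-i∣≡∣m-n∣+∣n-i∣ i≤n (<⇒≤ (≰⇒> m≰n)) ⟩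
  ∣ m - n ∣ + ∣ n - i ∣            ≡⟨ cong (_+ ∣ n - i ∣) (∣+m-+n∣≡∣m-n∣ m n) ⟨
  ∣ + m ℤ.- + n ∣ + ∣ n - i ∣      ∎
  where open ≡-Reasoning

nearest-in-box : ∀ v c a b → Σ ℕ λ i → Σ ℕ λ j → i ≤ a × j ≤ b ×
  (∀ {i′ j′} → i′ ≤ a → j′ ≤ b → d₁ v (c ⊕ (i′ , j′)) ≡ d₁ v (c ⊕ (i , j)) + d₁ℕ (i , j) (i′ , j′))
nearest-in-box (x , y) (cx , cy) a b
  with nearest-in-interval (x ℤ.- cx) a | nearest-in-interval (y ℤ.- cy) b
... | i , i≤a , along-x | j , j≤b , along-y = i , j , i≤a , j≤b , λ {i′} {j′} i′≤a j′≤b → begin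
  ∣ x ℤ.- (cx ℤ.+ + i′) ∣ + ∣ y ℤ.- (cy ℤ.+ + j′) ∣
    ≡⟨ cong₂ _+_ (cong ∣_∣ (shift x cx (+ i′))) (cong ∣_∣ (shift y cy (+ j′))) ⟩
  ∣ X ℤ.- + i′ ∣ + ∣ Y ℤ.- + j′ ∣
    ≡⟨ cong₂ _+_ (along-x i′≤a) (along-y j′≤b) ⟩
  (∣ X ℤ.- + i ∣ + ∣ i - i′ ∣) + (∣ Y ℤ.- + j ∣ + ∣ j - j′ ∣)
    ≡⟨ interchange (∣ X ℤ.- + i ∣) (∣ i - i′ ∣) (∣ Y ℤ.- + j ∣) (∣ j - j′ ∣) ⟩
  (∣ X ℤ.- + i ∣ + ∣ Y ℤ.- + j ∣) + d₁ℕ (i , j) (i′ , j′)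
    ≡⟨ cong (_+ d₁ℕ (i , j) (i′ , j′)) (cong₂ _+_ (cong ∣_∣ (shift x cx (+ i))) (cong ∣_∣ (shift y cy (+ j)))) ⟨
  (∣ x ℤ.- (cx ℤ.+ + i) ∣ + ∣ y ℤ.- (cy ℤ.+ + j) ∣) + d₁ℕ (i , j) (i′ , j′)
    ∎
  where
  open ≡-Reasoning
  X = x ℤ.- cx
  Y = y ℤ.- cy
  shift : ∀ x c i → x ℤ.- (c ℤ.+ i) ≡ (x ℤ.- c) ℤ.- i
  shift = solve-∀

_++ⁱ_ : ∀ {S u v w} → WalkIn S u v → WalkIn S v w → WalkIn S u w
here _         ++ⁱ q = q
step u∈S adj p ++ⁱ q = step u∈S adj (p ++ⁱ q)

WalkIn-start : ∀ {S u w} → WalkIn S u w → u ∈ S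
WalkIn-start (here u∈S)     = u∈S
WalkIn-start (step u∈S _ _) = u∈S

reverseⁱ : ∀ {S u w} → WalkIn S u w → WalkIn S w u
reverseⁱ (here u∈S) = here u∈S
reverseⁱ {u = u} (step {v = v} u∈S adj p) = reverseⁱ p ++ⁱ step (WalkIn-start p) (Adj-sym u v adj) (here u∈S)

BoxAdj : (m n : ℕ) → Fin m × Fin n → Fin m × Fin n → Set
BoxAdj m n (x , i) (y , j) = (x ≡ y × PathAdj n i j) ⊎ (i ≡ j × PathAdj m x y)

-- ComponentIsoGrid k is definitionally ComponentIsoBox 2 k.
ComponentIsoBox : (m n : ℕ) → Pred V 0ℓ → V → Set
ComponentIsoBox m n S c =
  Σ (Fin m × Fin n → V) λ f →
    (∀ x y → f x ≡ f y → x ≡ y) ×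
    (∀ w → Conn S c w ⇔ (∃[ x ] f x ≡ w)) ×
    (∀ x y → BoxAdj m n x y ⇔ Adj (f x) (f y))

module Boxes {I : Set} (corner : I → V) (a b : ℕ) where

  InBox : I → V → Set
  InBox α u = Σ ℕ λ i → Σ ℕ λ j → i ≤ a × j ≤ b × u ≡ corner α ⊕ (i , j)

  Union : Pred V 0ℓ
  Union u = ∃[ α ] InBox α u

  box-adjacent : ∀ α p p′ → d₁ℕ p p′ ≡ 1 → Adj (corner α ⊕ p) (corner α ⊕ p′)
  box-adjacent α p p′ e = d₁≡1⇒Adj (corner α ⊕ p) (corner α ⊕ p′) (trans (d₁-⊕ (corner α) p p′) e)

  walk-to-corner : ∀ α {i j} → i ≤ a → j ≤ b → WalkIn Union (corner α ⊕ (i , j)) (corner α ⊕ (0 , 0))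
  walk-to-corner α {zero} {zero} _ _ = here (α , 0 , 0 , z≤n , z≤n , refl)
  walk-to-corner α {zero} {suc j} _ j<b =
    step (α , 0 , suc j , z≤n , j<b , refl) (box-adjacent α (0 , suc j) (0 , j) (∣1+n-n∣≡1 j))
         (walk-to-corner α z≤n (<⇒≤ j<b))
  walk-to-corner α {suc i} {j} i<a j≤b =
    step (α , suc i , j , i<a , j≤b , refl) (box-adjacent α (suc i , j) (i , j) (cong₂ _+_ (∣1+n-n∣≡1 i) (∣n-n∣≡0 j)))
         (walk-to-corner α (<⇒≤ i<a) j≤b)

  box-connected : ∀ {α u w} → InBox α u → InBox α w → WalkIn Union u w
  box-connected {α} (i , j , i≤a , j≤b , refl) (i′ , j′ , i′≤a , j′≤b , refl) =
    walk-to-corner α i≤a j≤b ++ⁱ reverseⁱ (walk-to-corner α i′≤a j′≤b)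

  module Packing (t : ℕ) (1≤t : 1 ≤ t)
    (separated : ∀ {α β u w} → InBox α u → InBox β w → d₁ u w ≤ t + t → α ≡ β) where

    stays-in-box : ∀ {α u w} → WalkIn Union u w → InBox α u → InBox α w
    stays-in-box (here _) u∈α = u∈α
    stays-in-box {u = u} (step {v = v} _ adj p) u∈α with WalkIn-start p
    ... | β , v∈β with separated u∈α v∈β (≤-trans (≤-reflexive (Adj⇒d₁≡1 u v adj)) (≤-trans 1≤t (m≤m+n t t)))
    ... | refl = stays-in-box p v∈β

    isPDDS : (∀ v → Σ I λ α → Σ V λ u → InBox α u × d₁ v u ≤ t) → IsPDDS t Union
    isPDDS covered v with covered v
    ... | α , _ , (i₀ , j₀ , i₀≤a , j₀≤b , refl) , d≤t with nearest-in-box v (corner α) a b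
    ... | i , j , i≤a , j≤b , split =
      w , (α , w∈α) , (w , d₁ v w , here (α , w∈α) , Dist-d₁ v w , δ≤t , unique-nearest) , unique-component
      where
      w = corner α ⊕ (i , j)
      w∈α : InBox α w
      w∈α = i , j , i≤a , j≤b , refl
      δ≤t : d₁ v w ≤ t
      δ≤t = ≤-trans (≤-trans (m≤m+n (d₁ v w) _) (≤-reflexive (sym (split i₀≤a j₀≤b)))) d≤t
      unique-nearest : ∀ w′ δ′ → Conn Union w w′ → w′ ≢ w → Dist v w′ δ′ → d₁ v w < δ′
      unique-nearest w′ δ′ w~w′ w′≢w (walk , _) with stays-in-box w~w′ w∈α
      ... | i′ , j′ , i′≤a , j′≤b , refl = begin-strict
        d₁ v w                           <⟨ m<m+n (d₁ v w) (n≢0⇒n>0 (λ d≡0 → w′≢w (sym (cong (corner α ⊕_) (d₁ℕ≡0⇒≡ (i , j) (i′ , j′) d≡0))))) ⟩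
        d₁ v w + d₁ℕ (i , j) (i′ , j′)   ≡⟨ split i′≤a j′≤b ⟨
        d₁ v w′                          ≤⟨ d₁≤length walk ⟩
        δ′                               ∎
        where open ≤-Reasoning
      unique-component : ∀ c′ w′ δ′ → Conn Union c′ w′ → Dist v w′ δ′ → δ′ ≤ t → Conn Union w c′
      unique-component c′ w′ δ′ c′~w′ (walk , _) δ′≤t with WalkIn-start c′~w′
      ... | β , c′∈β with separated w∈α (stays-in-box c′~w′ c′∈β) close
        where
        close : d₁ w w′ ≤ t + t
        close = begin
          d₁ w w′           ≤⟨ d₁-triangle w v w′ ⟩
          d₁ w v + d₁ v w′  ≡⟨ cong (_+ d₁ v w′) (d₁-sym w v) ⟩
          d₁ v w + d₁ v w′  ≤⟨ +-mono-≤ δ≤t (≤-trans (d₁≤length walk) δ′≤t) ⟩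
          t + t             ∎
          where open ≤-Reasoning
      ... | refl = box-connected w∈α c′∈β

    component-iso : ∀ c → c ∈ Union → ComponentIsoBox (suc a) (suc b) Union c
    component-iso c (α , c∈α) = f , f-injective , (λ w → mk⇔ to from) , λ x y → mk⇔ (adj-to x y) (adj-from x y)
      where
      coords : Fin (suc a) × Fin (suc b) → ℕ × ℕ
      coords (x , y) = toℕ x , toℕ y
      f : Fin (suc a) × Fin (suc b) → V
      f p = corner α ⊕ coords p
      d₁-f : ∀ p q → d₁ (f p) (f q) ≡ d₁ℕ (coords p) (coords q)
      d₁-f p q = d₁-⊕ (corner α) (coords p) (coords q)
      f-injective : ∀ p q → f p ≡ f q → p ≡ q
      f-injective p q e = cong₂ _,_ (toℕ-injective (cong proj₁ same)) (toℕ-injective (cong proj₂ same))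
        where
        same : coords p ≡ coords q
        same = d₁ℕ≡0⇒≡ (coords p) (coords q) (trans (sym (d₁-f p q)) (trans (cong (d₁ (f p)) (sym e)) (d₁-self (f p))))
      to : ∀ {w} → Conn Union c w → ∃[ p ] f p ≡ w
      to c~w with stays-in-box c~w c∈α
      ... | i , j , i≤a , j≤b , refl =
        (fromℕ< (s≤s i≤a) , fromℕ< (s≤s j≤b)) , cong₂ (λ i j → corner α ⊕ (i , j)) (toℕ-fromℕ< (s≤s i≤a)) (toℕ-fromℕ< (s≤s j≤b))
      from : ∀ {w} → ∃[ p ] f p ≡ w → Conn Union c w
      from ((x , y) , refl) = box-connected c∈α (toℕ x , toℕ y , ≤-pred (toℕ<n x) , ≤-pred (toℕ<n y) , refl)
      adj-to : ∀ p q → BoxAdj (suc a) (suc b) p q → Adj (f p) (f q)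
      adj-to (x , i) (y , j) (inj₁ (refl , i~j)) =
        box-adjacent α (coords (x , i)) (coords (y , j)) (cong₂ _+_ (∣n-n∣≡0 (toℕ x)) (adjacent⇒∣m-n∣≡1 i~j))
      adj-to (x , i) (y , j) (inj₂ (refl , x~y)) =
        box-adjacent α (coords (x , i)) (coords (y , j)) (cong₂ _+_ (adjacent⇒∣m-n∣≡1 x~y) (∣n-n∣≡0 (toℕ i)))
      adj-from : ∀ p q → Adj (f p) (f q) → BoxAdj (suc a) (suc b) p q
      adj-from p@(x , i) q@(y , j) adj with m+n≡1⇒m≡0×n≡1⊎m≡1×n≡0 ∣ toℕ x - toℕ y ∣ ∣ toℕ i - toℕ j ∣ (trans (sym (d₁-f p q)) (Adj⇒d₁≡1 (f p) (f q) adj))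
      ... | inj₁ (dx≡0 , di≡1) = inj₁ (toℕ-injective (∣m-n∣≡0⇒m≡n dx≡0) , ∣m-n∣≡1⇒adjacent (toℕ i) (toℕ j) di≡1)
      ... | inj₂ (dx≡1 , di≡0) = inj₂ (toℕ-injective (∣m-n∣≡0⇒m≡n di≡0) , ∣m-n∣≡1⇒adjacent (toℕ x) (toℕ y) dx≡1)

-- A lattice packing of 2 × k boxes

module Lattice (t k₀ : ℕ) where

  h M : ℕ
  h = suc t
  M = suc (t + k₀)

  corner : ℤ × ℤ → V
  corner (p , q) = (p ℤ.* (+ h ℤ.+ + h) ℤ.+ q ℤ.* + h , q ℤ.* + M)

  open Boxes corner 1 k₀ public

  -- For boxes with indices (p , q) and (p′ , q′), A = ∣ 2(p − p′) + (q − q′) ∣ and d = ∣ q − q′ ∣,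
  -- while ex and ey are the coordinate distances between a point of each box.
  lattice-gap : ∀ A d {ex ey} → A * h ≤ ex + 1 → d * M ≤ ey + k₀ → ex + ey ≤ t + t →
                (d ≡ 0 × A ≤ 1) ⊎ (d ≡ 1 × A ≡ 0)
  lattice-gap A 0 {ex} hx _ close = inj₁ (refl , ≤-pred (*-cancelʳ-< h A 2 (begin-strict
    A * h       ≤⟨ hx ⟩
    ex + 1      ≤⟨ +-monoˡ-≤ 1 (m+n≤o⇒m≤o ex close) ⟩
    t + t + 1   <⟨ ≤-reflexive (two-rows t) ⟩
    2 * h       ∎)))
    where
    open ≤-Reasoning
    two-rows : ∀ t → suc (t + t + 1) ≡ 2 * suc t
    two-rows = NS.solve-∀
  lattice-gap A 1 {ex} {ey} hx hy close = inj₂ (refl , n<1⇒n≡0 (*-cancelʳ-< h A 1 (begin-strict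
    A * h       ≤⟨ hx ⟩
    ex + 1      ≡⟨ +-comm ex 1 ⟩
    suc ex      ≤⟨ +-cancelʳ-≤ t (suc ex) t (≤-trans (≤-reflexive (sym (+-suc ex t))) (≤-trans (+-monoʳ-≤ ex below) close)) ⟩
    t           <⟨ ≤-refl ⟩
    suc t       ≡⟨ *-identityˡ h ⟨
    1 * h       ∎)))
    where
    open ≤-Reasoning
    below : suc t ≤ ey
    below = +-cancelʳ-≤ k₀ (suc t) ey (≤-trans (≤-reflexive (sym (*-identityˡ M))) hy)
  lattice-gap A (suc (suc d)) {ey = ey} _ hy close = contradiction (*-cancelʳ-< M (suc (suc d)) 2 (begin-strict
    suc (suc d) * M   ≤⟨ hy ⟩
    ey + k₀           ≤⟨ +-monoˡ-≤ k₀ (m+n≤o⇒n≤o _ close) ⟩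
    t + t + k₀        <⟨ m≤m+n _ (suc k₀) ⟩
    suc (t + t + k₀) + suc k₀ ≡⟨ two-layers t k₀ ⟩
    2 * M             ∎)) λ { (s≤s (s≤s ())) }
    where
    open ≤-Reasoning
    two-layers : ∀ t k₀ → suc (t + t + k₀) + suc k₀ ≡ 2 * suc (t + k₀)
    two-layers = NS.solve-∀

  separated : ∀ {α β u w} → InBox α u → InBox β w → d₁ u w ≤ t + t → α ≡ β
  separated {p , q} {p′ , q′} (i , j , i≤1 , j≤k₀ , refl) (i′ , j′ , i′≤1 , j′≤k₀ , refl) close
    with small-2P+D⇒P≡0×D≡0 P D (lattice-gap ∣ A ∣ ∣ D ∣ x-gap y-gap close)
    where
    P = p ℤ.- p′
    D = q ℤ.- q′
    A = P ℤ.+ P ℤ.+ D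
    Δx : ∀ p q p′ q′ H i i′ → (p ℤ.* (H ℤ.+ H) ℤ.+ q ℤ.* H ℤ.+ i) ℤ.- (p′ ℤ.* (H ℤ.+ H) ℤ.+ q′ ℤ.* H ℤ.+ i′)
                              ≡ ((p ℤ.- p′) ℤ.+ (p ℤ.- p′) ℤ.+ (q ℤ.- q′)) ℤ.* H ℤ.+ (i ℤ.- i′)
    Δx = solve-∀
    Δy : ∀ q q′ M j j′ → (q ℤ.* M ℤ.+ j) ℤ.- (q′ ℤ.* M ℤ.+ j′) ≡ (q ℤ.- q′) ℤ.* M ℤ.+ (j ℤ.- j′)
    Δy = solve-∀
    x-gap = subst (λ z → ∣ A ∣ * h ≤ ∣ z ∣ + 1) (sym (Δx p q p′ q′ (+ h) (+ i) (+ i′))) (∣A∣*c≤∣A*c+[m-n]∣+l A h i≤1 i′≤1)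
    y-gap = subst (λ z → ∣ D ∣ * M ≤ ∣ z ∣ + k₀) (sym (Δy q q′ (+ M) (+ j) (+ j′))) (∣A∣*c≤∣A*c+[m-n]∣+l D M j≤k₀ j′≤k₀)
  ... | P≡0 , D≡0 = cong₂ _,_ (ℤₚ.i-j≡0⇒i≡j p p′ P≡0) (ℤₚ.i-j≡0⇒i≡j q q′ D≡0)

  data Neighbour : Set where
    self east north : Neighbour

  move : Neighbour → ℤ × ℤ → ℤ × ℤ
  move self  α       = α
  move east  (p , q) = (p ℤ.+ + 1 , q)
  move north (p , q) = (p , q ℤ.+ + 1)

  offset : Neighbour → ℕ × ℕ → ℕ × ℕ
  offset self  (i , j) = (i , j)
  offset east  (i , j) = (i + (h + h) , j)
  offset north (i , j) = (i + h , j + M)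

  corner-move : ∀ n α i j → corner (move n α) ⊕ (i , j) ≡ corner α ⊕ offset n (i , j)
  corner-move self  _       _ _ = refl
  corner-move east  (p , q) i j =
    cong (_, q ℤ.* + M ℤ.+ + j)
      (trans (step-east p q (+ h) (+ i)) (cong (λ z → p ℤ.* (+ h ℤ.+ + h) ℤ.+ q ℤ.* + h ℤ.+ z) (sym (pos-+³ i h h))))
    where
    step-east : ∀ p q H i → (p ℤ.+ + 1) ℤ.* (H ℤ.+ H) ℤ.+ q ℤ.* H ℤ.+ i ≡ p ℤ.* (H ℤ.+ H) ℤ.+ q ℤ.* H ℤ.+ (i ℤ.+ (H ℤ.+ H))
    step-east = solve-∀
    pos-+³ : ∀ i a b → + (i + (a + b)) ≡ + i ℤ.+ (+ a ℤ.+ + b)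
    pos-+³ i a b = trans (ℤₚ.pos-+ i (a + b)) (cong (λ z → + i ℤ.+ z) (ℤₚ.pos-+ a b))
  corner-move north (p , q) i j = cong₂ _,_
    (trans (step-north p q (+ h) (+ i)) (cong (λ z → p ℤ.* (+ h ℤ.+ + h) ℤ.+ q ℤ.* + h ℤ.+ z) (sym (ℤₚ.pos-+ i h))))
    (trans (step-up q (+ M) (+ j)) (cong (λ z → q ℤ.* + M ℤ.+ z) (sym (ℤₚ.pos-+ j M))))
    where
    step-north : ∀ p q H i → p ℤ.* (H ℤ.+ H) ℤ.+ (q ℤ.+ + 1) ℤ.* H ℤ.+ i ≡ p ℤ.* (H ℤ.+ H) ℤ.+ q ℤ.* H ℤ.+ (i ℤ.+ H)
    step-north = solve-∀
    step-up : ∀ q M j → (q ℤ.+ + 1) ℤ.* M ℤ.+ j ≡ q ℤ.* M ℤ.+ (j ℤ.+ M)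
    step-up = solve-∀

  decompose : ∀ v → Σ (ℤ × ℤ) λ α → Σ ℕ λ s → Σ ℕ λ r → s < h + h × r < M × v ≡ corner α ⊕ (s , r)
  decompose (x , y) = (p , q) , s , r , n%ℕd<d z (h + h) , n%ℕd<d y M , cong₂ _,_ x≡ y≡
    where
    q = y /ℕ M
    r = y %ℕ M
    z = x ℤ.- q ℤ.* + h
    p = z /ℕ (h + h)
    s = z %ℕ (h + h)
    x≡ : x ≡ p ℤ.* (+ h ℤ.+ + h) ℤ.+ q ℤ.* + h ℤ.+ + s
    x≡ = begin
      x                                                 ≡⟨ split x (q ℤ.* + h) ⟩
      z ℤ.+ q ℤ.* + h                                   ≡⟨ cong (ℤ._+ q ℤ.* + h) (a≡a%ℕn+[a/ℕn]*n z (h + h)) ⟩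
      + s ℤ.+ p ℤ.* + (h + h) ℤ.+ q ℤ.* + h             ≡⟨ cong (λ w → + s ℤ.+ p ℤ.* w ℤ.+ q ℤ.* + h) (ℤₚ.pos-+ h h) ⟩
      + s ℤ.+ p ℤ.* (+ h ℤ.+ + h) ℤ.+ q ℤ.* + h         ≡⟨ rotate (+ s) p q (+ h) ⟩
      p ℤ.* (+ h ℤ.+ + h) ℤ.+ q ℤ.* + h ℤ.+ + s         ∎
      where
      open ≡-Reasoning
      split : ∀ x a → x ≡ (x ℤ.- a) ℤ.+ a
      split = solve-∀
      rotate : ∀ s p q H → s ℤ.+ p ℤ.* (H ℤ.+ H) ℤ.+ q ℤ.* H ≡ p ℤ.* (H ℤ.+ H) ℤ.+ q ℤ.* H ℤ.+ s
      rotate = solve-∀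
    y≡ : y ≡ q ℤ.* + M ℤ.+ + r
    y≡ = trans (a≡a%ℕn+[a/ℕn]*n y M) (ℤₚ.+-comm (+ r) (q ℤ.* + M))

  CellCovered : ℕ → ℕ → Set
  CellCovered s r = Σ Neighbour λ n → Σ ℕ λ i → Σ ℕ λ j → i ≤ 1 × j ≤ k₀ × d₁ℕ (s , r) (offset n (i , j)) ≤ t

  covered-by-either : ∀ {s r} n₁ i₁ j₁ n₂ i₂ j₂ → i₁ ≤ 1 → j₁ ≤ k₀ → i₂ ≤ 1 → j₂ ≤ k₀ →
    d₁ℕ (s , r) (offset n₁ (i₁ , j₁)) + d₁ℕ (s , r) (offset n₂ (i₂ , j₂)) ≡ t + suc t → CellCovered s r
  covered-by-either n₁ i₁ j₁ n₂ i₂ j₂ i₁≤1 j₁≤k₀ i₂≤1 j₂≤k₀ total with m+n≡o+1+o⇒m≤o⊎n≤o total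
  ... | inj₁ close = n₁ , i₁ , j₁ , i₁≤1 , j₁≤k₀ , close
  ... | inj₂ close = n₂ , i₂ , j₂ , i₂≤1 , j₂≤k₀ , close

  below-and-above : ∀ {s r a₁ a₂} → ∣ s - a₁ ∣ + ∣ s - a₂ ∣ ≡ t → k₀ < r → r < M →
    d₁ℕ (s , r) (a₁ , k₀) + d₁ℕ (s , r) (a₂ , M) ≡ t + suc t
  below-and-above {s} {r} {a₁} {a₂} horizontal k₀<r r<M = begin
    (∣ s - a₁ ∣ + ∣ r - k₀ ∣) + (∣ s - a₂ ∣ + ∣ r - M ∣)  ≡⟨ interchange (∣ s - a₁ ∣) (∣ r - k₀ ∣) (∣ s - a₂ ∣) (∣ r - M ∣) ⟩
    (∣ s - a₁ ∣ + ∣ s - a₂ ∣) + (∣ r - k₀ ∣ + ∣ r - M ∣)  ≡⟨ cong₂ _+_ horizontal (∣y-x∣+∣y-z∣≡∣z-x∣ (<⇒≤ k₀<r) (<⇒≤ r<M)) ⟩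
    t + ∣ M - k₀ ∣                                       ≡⟨ cong (λ z → t + z) (m≤n⇒∣n-m∣≡n∸m (m≤n+m k₀ (suc t))) ⟩
    t + (suc t + k₀ ∸ k₀)                                ≡⟨ cong (λ z → t + z) (m+n∸n≡m (suc t) k₀) ⟩
    t + suc t                                            ∎
    where open ≡-Reasoning

  in-row : ∀ {s r} → s < h + h → r ≤ k₀ → CellCovered s r
  in-row {zero} {r} _ r≤k₀ = self , 0 , r , z≤n , r≤k₀ , subst (_≤ t) (sym (∣n-n∣≡0 r)) z≤n
  in-row {suc s} {r} s<2h r≤k₀ with s ≤? t
  ... | yes s≤t = self , 1 , r , ≤-refl , r≤k₀ ,
    subst (_≤ t) (sym (trans (cong₂ _+_ (∣-∣-identityʳ s) (∣n-n∣≡0 r)) (+-identityʳ s))) s≤t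
  ... | no  s≰t = east , 0 , r , z≤n , r≤k₀ , subst (_≤ t) (sym (trans (cong₂ _+_ east-gap (∣n-n∣≡0 r)) (+-identityʳ _))) (begin
    h + h ∸ suc s       ≤⟨ ∸-monoʳ-≤ (h + h) (s≤s (≰⇒> s≰t)) ⟩
    h + h ∸ suc h       ≡⟨ m+n∸n≡m t (suc t) ⟩
    t                   ∎)
    where
    open ≤-Reasoning
    east-gap : ∣ suc s - (h + h) ∣ ≡ h + h ∸ suc s
    east-gap = m≤n⇒∣m-n∣≡n∸m (<⇒≤ s<2h)

  between-rows : ∀ {s r} → s < h + h → k₀ < r → r < M → CellCovered s r
  between-rows {zero} {r} _ k₀<r r<M = self , 0 , k₀ , z≤n , ≤-refl ,
    subst (_≤ t) (sym (m≤n⇒∣n-m∣≡n∸m (<⇒≤ k₀<r))) (m≤n+o⇒m∸n≤o r k₀ (subst (r ≤_) (+-comm t k₀) (≤-pred r<M)))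
  between-rows {suc s} {r} s<2h k₀<r r<M with s ≤? t
  ... | yes s≤t = covered-by-either {suc s} {r} self 1 k₀ north 0 0 ≤-refl ≤-refl z≤n z≤n
    (below-and-above {suc s} {r} {1} {h} (trans (∣y-x∣+∣y-z∣≡∣z-x∣ z≤n s≤t) (∣-∣-identityʳ t)) k₀<r r<M)
  ... | no  s≰t = covered-by-either {suc s} {r} east 0 k₀ north 1 0 z≤n ≤-refl ≤-refl z≤n
    (below-and-above {suc s} {r} {h + h} {suc h} horizontal k₀<r r<M)
    where
    horizontal : ∣ suc s - (h + h) ∣ + ∣ suc s - suc h ∣ ≡ t
    horizontal = begin
      ∣ suc s - (h + h) ∣ + ∣ suc s - suc h ∣  ≡⟨ +-comm (∣ suc s - (h + h) ∣) (∣ suc s - suc h ∣) ⟩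
      ∣ suc s - suc h ∣ + ∣ suc s - (h + h) ∣  ≡⟨ ∣y-x∣+∣y-z∣≡∣z-x∣ (s≤s (≰⇒> s≰t)) (<⇒≤ s<2h) ⟩
      ∣ t + h - h ∣                            ≡⟨ m≤n⇒∣n-m∣≡n∸m (m≤n+m h t) ⟩
      t + h ∸ h                                ≡⟨ m+n∸n≡m t h ⟩
      t                                        ∎
      where open ≡-Reasoning

  cell-covered : ∀ {s r} → s < h + h → r < M → CellCovered s r
  cell-covered {r = r} s<2h r<M with r ≤? k₀
  ... | yes r≤k₀ = in-row s<2h r≤k₀
  ... | no  r≰k₀ = between-rows s<2h (≰⇒> r≰k₀) r<M

  covered : ∀ v → Σ (ℤ × ℤ) λ α → Σ V λ u → InBox α u × d₁ v u ≤ t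
  covered v with decompose v
  ... | α , s , r , s<2h , r<M , refl with cell-covered s<2h r<M
  ... | n , i , j , i≤1 , j≤k₀ , close = move n α , corner (move n α) ⊕ (i , j) , (i , j , i≤1 , j≤k₀ , refl) ,
    subst (_≤ t) (sym (trans (cong (d₁ (corner α ⊕ (s , r))) (corner-move n α i j)) (d₁-⊕ (corner α) (s , r) (offset n (i , j))))) close

theorem9 : (t k : ℕ) → 1 ≤ t → 1 ≤ k →
    Σ (Pred V 0ℓ) λ S → IsPDDS t S × (∀ c → c ∈ S → ComponentIsoGrid k S c)
theorem9 _ zero    _   ()
theorem9 t (suc k₀) 1≤t _ = Union , isPDDS covered , component-iso
  where
  open Lattice t k₀
  open Packing t 1≤t separated
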